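{- Let $t$ and $u$ be terms. If for every stack $\pi$ there is a process $p$ such that $t\ast\pi\succ^*p$ and $u\ast\pi\succ^*p$, then $t\equiv u$.
   Context: Fix pairwise disjoint countably infinite sets of $\lambda$-variables ($x,y,\dots$), stack variables ($\alpha,\beta,\dots$), term variables ($a,b,\dots$), and countable sets of labels $l$ and constructors $C$. Values, terms, stacks, processes: $v,w::=x\mid\lambda x\,t\mid C[v]\mid\{l_i=v_i\}_{i\in I}$; $t,u::=a\mid v\mid t\,u\mid\mu\alpha\,t\mid p\mid v.l\mid\mathrm{case}_v[C_i[x_i]\to t_i]_{i\in I}\mid\delta_{v,w}$; $\pi::=\alpha\mid v.\pi\mid[t]\pi$; $p::=t\ast\pi$; $I$ finite; $\lambda x$, $\mu\alpha$ and the $x_i$ in case branches are binders, term variables are never bound. Substitutions map $\lambda$-variables to values, stack variables to stacks, term variables to terms (capture-avoiding). $\succ$ is the smallest relation on processes with: $t\,u\ast\pi\succ u\ast[t]\pi$; $v\ast[t]\pi\succ t\ast v.\pi$; $\lambda x\,t\ast v.\pi\succ t[x:=v]\ast\pi$; $\mu\alpha\,t\ast\pi\succ t[\alpha:=\pi]\ast\pi$; $p\ast\pi\succ p$; $\{l_i=v_i\}_{i\in I}.l_k\ast\pi\succ v_k\ast\pi$ ($k\in I$); $\mathrm{case}_{C_k[v]}[C_i[x_i]\to t_i]_{i\in I}\ast\pi\succ t_k[x_k:=v]\ast\pi$ ($k\in I$); $\succ^*$ is its reflexive-transitive closure. A process is final if it is $v\ast\alpha$ with $v$ a value and $\alpha$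 a stack variable; for a relation $R$, $p\Downarrow_R$ means $p\,R^*\,q$ with $q$ final. For $i\in\mathbb N$, inductively: $\rightsquigarrow_i=\succ\cup\{(\delta_{v,w}\ast\pi,v\ast\pi)\mid\exists j<i,\ v\not\equiv_jw\}$; $t\equiv_iu$ iff for all $j\le i$, stacks $\pi$, substitutions $\sigma$: $t\sigma\ast\pi\Downarrow_{\rightsquigarrow_j}\Leftrightarrow u\sigma\ast\pi\Downarrow_{\rightsquigarrow_j}$; $\not\equiv_i$ is its negation. $\equiv=\bigcap_i\equiv_i$. -}

module Defs where

open import Data.Nat using (ℕ; zero; suc)
open import Data.List using (List; []; _∷_)
open import Data.Maybe using (Maybe; just; nothing)
open import Data.Product using (Σ; _×_; _,_)
open import Data.Sum using (_⊎_)
open import Data.Empty using (⊥)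
open import Data.Unit using (⊤)
open import Relation.Nullary using (¬_)
open import Relation.Binary.PropositionalEquality using (_≡_)
open import Relation.Binary.Construct.Closure.ReflexiveTransitive using (Star)

-- Syntax.
-- λ-variables and stack variables: de Bruijn indices (ℕ); binders are
-- λx (binds λ-variable 0), μα (binds stack variable 0), and each case
-- branch C_i[x_i] → t_i (binds λ-variable 0 in t_i).
-- Term variables: names in ℕ, never bound.
-- A record {l_i = v_i}_{i∈I} (I finite) is a finite partial map from labels
-- to values, represented as List (Maybe Val): position l holds just v_l
-- iff l ∈ I.  Similarly the branches of a case are a List (Maybe Term)
-- indexed by constructors.

mutual
  data Val : Set where
    var : ℕ → Val
    lam : Term → Val
    con : ℕ → Val → Val
    rec : List (Maybe Val) → Val

  data Term : Set where
    tvar  : ℕ → Term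
    val   : Val → Term
    app   : Term → Term → Term
    mu    : Term → Term
    proc  : Proc → Term
    proj  : Val → ℕ → Term
    case  : Val → List (Maybe Term) → Term
    delta : Val → Val → Term

  data Stack : Set where
    svar  : ℕ → Stack
    push  : Val → Stack → Stack
    frame : Term → Stack → Stack

  data Proc : Set where
    _∗_ : Term → Stack → Proc

infix 4 _∗_

record Ren : Set where
  field
    rλ : ℕ → ℕ
    rs : ℕ → ℕ
open Ren

ext : (ℕ → ℕ) → ℕ → ℕ
ext ρ zero    = zero
ext ρ (suc n) = suc (ρ n)

extλR : Ren → Ren
extλR ρ = record { rλ = ext (rλ ρ) ; rs = rs ρ }

extμR : Ren → Ren
extμR ρ = record { rλ = rλ ρ ; rs = ext (rs ρ) }

mutual
  renV : Ren → Val → Val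
  renV ρ (var x)   = var (rλ ρ x)
  renV ρ (lam t)   = lam (renT (extλR ρ) t)
  renV ρ (con c v) = con c (renV ρ v)
  renV ρ (rec fs)  = rec (renFs ρ fs)

  renFs : Ren → List (Maybe Val) → List (Maybe Val)
  renFs ρ [] = []
  renFs ρ (nothing ∷ fs) = nothing ∷ renFs ρ fs
  renFs ρ (just v ∷ fs)  = just (renV ρ v) ∷ renFs ρ fs

  renBs : Ren → List (Maybe Term) → List (Maybe Term)
  renBs ρ [] = []
  renBs ρ (nothing ∷ bs) = nothing ∷ renBs ρ bs
  renBs ρ (just t ∷ bs)  = just (renT (extλR ρ) t) ∷ renBs ρ bs

  renT : Ren → Term → Term
  renT ρ (tvar a)    = tvar a
  renT ρ (val v)     = val (renV ρ v)
  renT ρ (app t u)   = app (renT ρ t) (renT ρ u)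
  renT ρ (mu t)      = mu (renT (extμR ρ) t)
  renT ρ (proc p)    = proc (renP ρ p)
  renT ρ (proj v l)  = proj (renV ρ v) l
  renT ρ (case v bs) = case (renV ρ v) (renBs ρ bs)
  renT ρ (delta v w) = delta (renV ρ v) (renV ρ w)

  renS : Ren → Stack → Stack
  renS ρ (svar α)    = svar (rs ρ α)
  renS ρ (push v π)  = push (renV ρ v) (renS ρ π)
  renS ρ (frame t π) = frame (renT ρ t) (renS ρ π)

  renP : Ren → Proc → Proc
  renP ρ (t ∗ π) = renT ρ t ∗ renS ρ π

idR : Ren
idR = record { rλ = λ n → n ; rs = λ n → n }

shλ : Ren
shλ = record { rλ = suc ; rs = λ n → n }

shμ : Ren
shμ = record { rλ = λ n → n ; rs = suc }

record Sub : Set where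
  field
    sλ : ℕ → Val
    ss : ℕ → Stack
    st : ℕ → Term
open Sub

cons : {A : Set} → A → (ℕ → A) → ℕ → A
cons a f zero    = a
cons a f (suc n) = f n

liftλ : Sub → Sub
liftλ σ = record
  { sλ = cons (var zero) (λ n → renV shλ (sλ σ n))
  ; ss = λ n → renS shλ (ss σ n)
  ; st = λ n → renT shλ (st σ n) }

liftμ : Sub → Sub
liftμ σ = record
  { sλ = λ n → renV shμ (sλ σ n)
  ; ss = cons (svar zero) (λ n → renS shμ (ss σ n))
  ; st = λ n → renT shμ (st σ n) }

mutual
  subV : Sub → Val → Val
  subV σ (var x)   = sλ σ x
  subV σ (lam t)   = lam (subT (liftλ σ) t)
  subV σ (con c v) = con c (subV σ v)
  subV σ (rec fs)  = rec (subFs σ fs)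

  subFs : Sub → List (Maybe Val) → List (Maybe Val)
  subFs σ [] = []
  subFs σ (nothing ∷ fs) = nothing ∷ subFs σ fs
  subFs σ (just v ∷ fs)  = just (subV σ v) ∷ subFs σ fs

  subBs : Sub → List (Maybe Term) → List (Maybe Term)
  subBs σ [] = []
  subBs σ (nothing ∷ bs) = nothing ∷ subBs σ bs
  subBs σ (just t ∷ bs)  = just (subT (liftλ σ) t) ∷ subBs σ bs

  subT : Sub → Term → Term
  subT σ (tvar a)    = st σ a
  subT σ (val v)     = val (subV σ v)
  subT σ (app t u)   = app (subT σ t) (subT σ u)
  subT σ (mu t)      = mu (subT (liftμ σ) t)
  subT σ (proc p)    = proc (subP σ p)
  subT σ (proj v l)  = proj (subV σ v) l
  subT σ (case v bs) = case (subV σ v) (subBs σ bs)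
  subT σ (delta v w) = delta (subV σ v) (subV σ w)

  subS : Sub → Stack → Stack
  subS σ (svar α)    = ss σ α
  subS σ (push v π)  = push (subV σ v) (subS σ π)
  subS σ (frame t π) = frame (subT σ t) (subS σ π)

  subP : Sub → Proc → Proc
  subP σ (t ∗ π) = subT σ t ∗ subS σ π

idS : Sub
idS = record { sλ = var ; ss = svar ; st = tvar }

_[λ:=_] : Term → Val → Term
t [λ:= v ] = subT (record idS { sλ = cons v var }) t

_[μ:=_] : Term → Stack → Term
t [μ:= π ] = subT (record idS { ss = cons π svar }) t

lookupM : {A : Set} → List (Maybe A) → ℕ → Maybe A
lookupM []       n       = nothing
lookupM (m ∷ ms) zero    = m
lookupM (m ∷ ms) (suc n) = lookupM ms n

infix 3 _≻_
data _≻_ : Proc → Proc → Set where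
  ≻-app   : ∀ {t u π} → app t u ∗ π ≻ u ∗ frame t π
  ≻-frame : ∀ {v t π} → val v ∗ frame t π ≻ t ∗ push v π
  ≻-lam   : ∀ {t v π} → val (lam t) ∗ push v π ≻ (t [λ:= v ]) ∗ π
  ≻-mu    : ∀ {t π} → mu t ∗ π ≻ (t [μ:= π ]) ∗ π
  ≻-proc  : ∀ {p π} → proc p ∗ π ≻ p
  ≻-proj  : ∀ {fs l v π} → lookupM fs l ≡ just v →
            proj (rec fs) l ∗ π ≻ val v ∗ π
  ≻-case  : ∀ {k v bs t π} → lookupM bs k ≡ just t →
            case (con k v) bs ∗ π ≻ (t [λ:= v ]) ∗ π

Final : Proc → Set
Final (val v ∗ svar α) = ⊤
Final _ = ⊥

Conv : (Proc → Proc → Set) → Proc → Set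
Conv R p = Σ Proc (λ q → Star R p q × Final q)

ObsEq : (Proc → Proc → Set) → Term → Term → Set
ObsEq R t u = ∀ (π : Stack) (σ : Sub) →
  (Conv R (subT σ t ∗ π) → Conv R (subT σ u ∗ π)) ×
  (Conv R (subT σ u ∗ π) → Conv R (subT σ t ∗ π))

mutual
  Red : ℕ → Proc → Proc → Set
  Red i p q = (p ≻ q) ⊎ DeltaStep i p q

  DeltaStep : ℕ → Proc → Proc → Set
  DeltaStep i p q =
    Σ Val λ v → Σ Val λ w → Σ Stack λ π →
      (p ≡ (delta v w ∗ π)) × (q ≡ (val v ∗ π)) × NEqBelow i (val v) (val w)

  NEqBelow : ℕ → Term → Term → Set
  NEqBelow zero    t u = ⊥
  NEqBelow (suc i) t u = NEqBelow i t u ⊎ ¬ Equiv i t u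

  Equiv : ℕ → Term → Term → Set
  Equiv zero    t u = ObsEq (Red zero) t u
  Equiv (suc i) t u = Equiv i t u × ObsEq (Red (suc i)) t u

_≡obs_ : Term → Term → Set
t ≡obs u = ∀ i → Equiv i t u

-- Evaluation ≻ is deterministic, and the only extra steps of ↝ᵢ start from δ-headed
-- processes, which have no ≻-step; so convergence for ↝ᵢ is invariant along ≻*.  Given
-- σ and π, instantiate the hypothesis at a stack variable α that is fresh for t and u
-- and apply σ[α ↦ π] to the two reductions: this yields a common ≻-reduct of tσ ∗ π and
-- uσ ∗ π, so both converge or neither does, at every level i.
module Submission where

open import Defs
open import Data.Product using (Σ; _×_; _,_)
open import Relation.Binary.Construct.Closure.ReflexiveTransitive using (Star; ε; _◅_)
open import Data.Nat using (ℕ; zero; suc; _⊔_; _≤_; _<_; _≟_; z≤n; s≤s; pred)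
open import Data.Nat.Properties using (m⊔n≤o⇒m≤o; m⊔n≤o⇒n≤o; m≤m⊔n; m≤n⊔m; <⇒≢)
open import Data.List using (List; []; _∷_)
open import Data.Maybe using (Maybe; just; nothing)
open import Data.Maybe.Properties using (just-injective)
open import Data.Sum using (inj₁; inj₂)
open import Data.Empty using (⊥; ⊥-elim)
open import Relation.Nullary using (yes; no)
open import Relation.Binary.PropositionalEquality
  using (_≡_; refl; sym; trans; cong; cong₂; subst)

open Ren
open Sub

_∘R_ : Ren → Ren → Ren
ρ₂ ∘R ρ₁ = record { rλ = λ x → rλ ρ₂ (rλ ρ₁ x) ; rs = λ α → rs ρ₂ (rs ρ₁ α) }

_R∘S_ : Ren → Sub → Sub
ρ R∘S σ = record
  { sλ = λ x → renV ρ (sλ σ x) ; ss = λ α → renS ρ (ss σ α) ; st = λ a → renT ρ (st σ a) }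

_S∘R_ : Sub → Ren → Sub
σ S∘R ρ = record { sλ = λ x → sλ σ (rλ ρ x) ; ss = λ α → ss σ (rs ρ α) ; st = st σ }

record RenRen (ρ₁ ρ₂ ρ : Ren) : Set where
  field
    rr-λ : ∀ x → rλ ρ₂ (rλ ρ₁ x) ≡ rλ ρ x
    rr-s : ∀ α → rs ρ₂ (rs ρ₁ α) ≡ rs ρ α
open RenRen

renRen-∘R : ∀ ρ₁ ρ₂ → RenRen ρ₁ ρ₂ (ρ₂ ∘R ρ₁)
rr-λ (renRen-∘R ρ₁ ρ₂) x = refl
rr-s (renRen-∘R ρ₁ ρ₂) α = refl

ext-comp : ∀ {f g h : ℕ → ℕ} → (∀ x → f (g x) ≡ h x) → ∀ x → ext f (ext g x) ≡ ext h x
ext-comp H zero    = refl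
ext-comp H (suc x) = cong suc (H x)

renRen-extλ : ∀ {ρ₁ ρ₂ ρ} → RenRen ρ₁ ρ₂ ρ → RenRen (extλR ρ₁) (extλR ρ₂) (extλR ρ)
rr-λ (renRen-extλ H) = ext-comp (rr-λ H)
rr-s (renRen-extλ H) = rr-s H

renRen-extμ : ∀ {ρ₁ ρ₂ ρ} → RenRen ρ₁ ρ₂ ρ → RenRen (extμR ρ₁) (extμR ρ₂) (extμR ρ)
rr-λ (renRen-extμ H) = rr-λ H
rr-s (renRen-extμ H) = ext-comp (rr-s H)

mutual
  renV-renV : ∀ {ρ₁ ρ₂ ρ} → RenRen ρ₁ ρ₂ ρ → ∀ v → renV ρ₂ (renV ρ₁ v) ≡ renV ρ v
  renV-renV H (var x)   = cong var (rr-λ H x)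
  renV-renV H (lam t)   = cong lam (renT-renT (renRen-extλ H) t)
  renV-renV H (con c v) = cong (con c) (renV-renV H v)
  renV-renV H (rec fs)  = cong rec (renFs-renFs H fs)

  renFs-renFs : ∀ {ρ₁ ρ₂ ρ} → RenRen ρ₁ ρ₂ ρ → ∀ fs → renFs ρ₂ (renFs ρ₁ fs) ≡ renFs ρ fs
  renFs-renFs H []             = refl
  renFs-renFs H (nothing ∷ fs) = cong (nothing ∷_) (renFs-renFs H fs)
  renFs-renFs H (just v ∷ fs)  = cong₂ (λ w ws → just w ∷ ws) (renV-renV H v) (renFs-renFs H fs)

  renBs-renBs : ∀ {ρ₁ ρ₂ ρ} → RenRen ρ₁ ρ₂ ρ → ∀ bs → renBs ρ₂ (renBs ρ₁ bs) ≡ renBs ρ bs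
  renBs-renBs H []             = refl
  renBs-renBs H (nothing ∷ bs) = cong (nothing ∷_) (renBs-renBs H bs)
  renBs-renBs H (just t ∷ bs)  =
    cong₂ (λ s ss → just s ∷ ss) (renT-renT (renRen-extλ H) t) (renBs-renBs H bs)

  renT-renT : ∀ {ρ₁ ρ₂ ρ} → RenRen ρ₁ ρ₂ ρ → ∀ t → renT ρ₂ (renT ρ₁ t) ≡ renT ρ t
  renT-renT H (tvar a)    = refl
  renT-renT H (val v)     = cong val (renV-renV H v)
  renT-renT H (app t u)   = cong₂ app (renT-renT H t) (renT-renT H u)
  renT-renT H (mu t)      = cong mu (renT-renT (renRen-extμ H) t)
  renT-renT H (proc p)    = cong proc (renP-renP H p)
  renT-renT H (proj v l)  = cong (λ w → proj w l) (renV-renV H v)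
  renT-renT H (case v bs) = cong₂ case (renV-renV H v) (renBs-renBs H bs)
  renT-renT H (delta v w) = cong₂ delta (renV-renV H v) (renV-renV H w)

  renS-renS : ∀ {ρ₁ ρ₂ ρ} → RenRen ρ₁ ρ₂ ρ → ∀ π → renS ρ₂ (renS ρ₁ π) ≡ renS ρ π
  renS-renS H (svar α)    = cong svar (rr-s H α)
  renS-renS H (push v π)  = cong₂ push (renV-renV H v) (renS-renS H π)
  renS-renS H (frame t π) = cong₂ frame (renT-renT H t) (renS-renS H π)

  renP-renP : ∀ {ρ₁ ρ₂ ρ} → RenRen ρ₁ ρ₂ ρ → ∀ p → renP ρ₂ (renP ρ₁ p) ≡ renP ρ p
  renP-renP H (t ∗ π) = cong₂ _∗_ (renT-renT H t) (renS-renS H π)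

record SubRen (ρ : Ren) (σ τ : Sub) : Set where
  field
    sr-λ : ∀ x → sλ σ (rλ ρ x) ≡ sλ τ x
    sr-s : ∀ α → ss σ (rs ρ α) ≡ ss τ α
    sr-t : ∀ a → st σ a ≡ st τ a
open SubRen

subRen-S∘R : ∀ ρ σ → SubRen ρ σ (σ S∘R ρ)
sr-λ (subRen-S∘R ρ σ) x = refl
sr-s (subRen-S∘R ρ σ) α = refl
sr-t (subRen-S∘R ρ σ) a = refl

subRen-liftλ : ∀ {ρ σ τ} → SubRen ρ σ τ → SubRen (extλR ρ) (liftλ σ) (liftλ τ)
sr-λ (subRen-liftλ H) zero    = refl
sr-λ (subRen-liftλ H) (suc x) = cong (renV shλ) (sr-λ H x)
sr-s (subRen-liftλ H) α       = cong (renS shλ) (sr-s H α)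
sr-t (subRen-liftλ H) a       = cong (renT shλ) (sr-t H a)

subRen-liftμ : ∀ {ρ σ τ} → SubRen ρ σ τ → SubRen (extμR ρ) (liftμ σ) (liftμ τ)
sr-λ (subRen-liftμ H) x       = cong (renV shμ) (sr-λ H x)
sr-s (subRen-liftμ H) zero    = refl
sr-s (subRen-liftμ H) (suc α) = cong (renS shμ) (sr-s H α)
sr-t (subRen-liftμ H) a       = cong (renT shμ) (sr-t H a)

mutual
  subV-renV : ∀ {ρ σ τ} → SubRen ρ σ τ → ∀ v → subV σ (renV ρ v) ≡ subV τ v
  subV-renV H (var x)   = sr-λ H x
  subV-renV H (lam t)   = cong lam (subT-renT (subRen-liftλ H) t)
  subV-renV H (con c v) = cong (con c) (subV-renV H v)
  subV-renV H (rec fs)  = cong rec (subFs-renFs H fs)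

  subFs-renFs : ∀ {ρ σ τ} → SubRen ρ σ τ → ∀ fs → subFs σ (renFs ρ fs) ≡ subFs τ fs
  subFs-renFs H []             = refl
  subFs-renFs H (nothing ∷ fs) = cong (nothing ∷_) (subFs-renFs H fs)
  subFs-renFs H (just v ∷ fs)  = cong₂ (λ w ws → just w ∷ ws) (subV-renV H v) (subFs-renFs H fs)

  subBs-renBs : ∀ {ρ σ τ} → SubRen ρ σ τ → ∀ bs → subBs σ (renBs ρ bs) ≡ subBs τ bs
  subBs-renBs H []             = refl
  subBs-renBs H (nothing ∷ bs) = cong (nothing ∷_) (subBs-renBs H bs)
  subBs-renBs H (just t ∷ bs)  =
    cong₂ (λ s ss → just s ∷ ss) (subT-renT (subRen-liftλ H) t) (subBs-renBs H bs)

  subT-renT : ∀ {ρ σ τ} → SubRen ρ σ τ → ∀ t → subT σ (renT ρ t) ≡ subT τ t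
  subT-renT H (tvar a)    = sr-t H a
  subT-renT H (val v)     = cong val (subV-renV H v)
  subT-renT H (app t u)   = cong₂ app (subT-renT H t) (subT-renT H u)
  subT-renT H (mu t)      = cong mu (subT-renT (subRen-liftμ H) t)
  subT-renT H (proc p)    = cong proc (subP-renP H p)
  subT-renT H (proj v l)  = cong (λ w → proj w l) (subV-renV H v)
  subT-renT H (case v bs) = cong₂ case (subV-renV H v) (subBs-renBs H bs)
  subT-renT H (delta v w) = cong₂ delta (subV-renV H v) (subV-renV H w)

  subS-renS : ∀ {ρ σ τ} → SubRen ρ σ τ → ∀ π → subS σ (renS ρ π) ≡ subS τ π
  subS-renS H (svar α)    = sr-s H α
  subS-renS H (push v π)  = cong₂ push (subV-renV H v) (subS-renS H π)
  subS-renS H (frame t π) = cong₂ frame (subT-renT H t) (subS-renS H π)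

  subP-renP : ∀ {ρ σ τ} → SubRen ρ σ τ → ∀ p → subP σ (renP ρ p) ≡ subP τ p
  subP-renP H (t ∗ π) = cong₂ _∗_ (subT-renT H t) (subS-renS H π)

record RenSub (σ : Sub) (ρ : Ren) (τ : Sub) : Set where
  field
    rs-λ : ∀ x → renV ρ (sλ σ x) ≡ sλ τ x
    rs-s : ∀ α → renS ρ (ss σ α) ≡ ss τ α
    rs-t : ∀ a → renT ρ (st σ a) ≡ st τ a
open RenSub

renSub-R∘S : ∀ σ ρ → RenSub σ ρ (ρ R∘S σ)
rs-λ (renSub-R∘S σ ρ) x = refl
rs-s (renSub-R∘S σ ρ) α = refl
rs-t (renSub-R∘S σ ρ) a = refl

-- Both sides of each equation below are the renaming by the composite of ρ and the shift.
renSub-liftλ : ∀ {σ ρ τ} → RenSub σ ρ τ → RenSub (liftλ σ) (extλR ρ) (liftλ τ)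
rs-λ (renSub-liftλ H) zero = refl
rs-λ (renSub-liftλ {σ} {ρ} H) (suc x) =
  trans (renV-renV (renRen-∘R shλ (extλR ρ)) (sλ σ x))
        (trans (sym (renV-renV (renRen-∘R ρ shλ) (sλ σ x))) (cong (renV shλ) (rs-λ H x)))
rs-s (renSub-liftλ {σ} {ρ} H) α =
  trans (renS-renS (renRen-∘R shλ (extλR ρ)) (ss σ α))
        (trans (sym (renS-renS (renRen-∘R ρ shλ) (ss σ α))) (cong (renS shλ) (rs-s H α)))
rs-t (renSub-liftλ {σ} {ρ} H) a =
  trans (renT-renT (renRen-∘R shλ (extλR ρ)) (st σ a))
        (trans (sym (renT-renT (renRen-∘R ρ shλ) (st σ a))) (cong (renT shλ) (rs-t H a)))

renSub-liftμ : ∀ {σ ρ τ} → RenSub σ ρ τ → RenSub (liftμ σ) (extμR ρ) (liftμ τ)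
rs-λ (renSub-liftμ {σ} {ρ} H) x =
  trans (renV-renV (renRen-∘R shμ (extμR ρ)) (sλ σ x))
        (trans (sym (renV-renV (renRen-∘R ρ shμ) (sλ σ x))) (cong (renV shμ) (rs-λ H x)))
rs-s (renSub-liftμ H) zero = refl
rs-s (renSub-liftμ {σ} {ρ} H) (suc α) =
  trans (renS-renS (renRen-∘R shμ (extμR ρ)) (ss σ α))
        (trans (sym (renS-renS (renRen-∘R ρ shμ) (ss σ α))) (cong (renS shμ) (rs-s H α)))
rs-t (renSub-liftμ {σ} {ρ} H) a =
  trans (renT-renT (renRen-∘R shμ (extμR ρ)) (st σ a))
        (trans (sym (renT-renT (renRen-∘R ρ shμ) (st σ a))) (cong (renT shμ) (rs-t H a)))

mutual
  renV-subV : ∀ {σ ρ τ} → RenSub σ ρ τ → ∀ v → renV ρ (subV σ v) ≡ subV τ v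
  renV-subV H (var x)   = rs-λ H x
  renV-subV H (lam t)   = cong lam (renT-subT (renSub-liftλ H) t)
  renV-subV H (con c v) = cong (con c) (renV-subV H v)
  renV-subV H (rec fs)  = cong rec (renFs-subFs H fs)

  renFs-subFs : ∀ {σ ρ τ} → RenSub σ ρ τ → ∀ fs → renFs ρ (subFs σ fs) ≡ subFs τ fs
  renFs-subFs H []             = refl
  renFs-subFs H (nothing ∷ fs) = cong (nothing ∷_) (renFs-subFs H fs)
  renFs-subFs H (just v ∷ fs)  = cong₂ (λ w ws → just w ∷ ws) (renV-subV H v) (renFs-subFs H fs)

  renBs-subBs : ∀ {σ ρ τ} → RenSub σ ρ τ → ∀ bs → renBs ρ (subBs σ bs) ≡ subBs τ bs
  renBs-subBs H []             = refl
  renBs-subBs H (nothing ∷ bs) = cong (nothing ∷_) (renBs-subBs H bs)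
  renBs-subBs H (just t ∷ bs)  =
    cong₂ (λ s ss → just s ∷ ss) (renT-subT (renSub-liftλ H) t) (renBs-subBs H bs)

  renT-subT : ∀ {σ ρ τ} → RenSub σ ρ τ → ∀ t → renT ρ (subT σ t) ≡ subT τ t
  renT-subT H (tvar a)    = rs-t H a
  renT-subT H (val v)     = cong val (renV-subV H v)
  renT-subT H (app t u)   = cong₂ app (renT-subT H t) (renT-subT H u)
  renT-subT H (mu t)      = cong mu (renT-subT (renSub-liftμ H) t)
  renT-subT H (proc p)    = cong proc (renP-subP H p)
  renT-subT H (proj v l)  = cong (λ w → proj w l) (renV-subV H v)
  renT-subT H (case v bs) = cong₂ case (renV-subV H v) (renBs-subBs H bs)
  renT-subT H (delta v w) = cong₂ delta (renV-subV H v) (renV-subV H w)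

  renS-subS : ∀ {σ ρ τ} → RenSub σ ρ τ → ∀ π → renS ρ (subS σ π) ≡ subS τ π
  renS-subS H (svar α)    = rs-s H α
  renS-subS H (push v π)  = cong₂ push (renV-subV H v) (renS-subS H π)
  renS-subS H (frame t π) = cong₂ frame (renT-subT H t) (renS-subS H π)

  renP-subP : ∀ {σ ρ τ} → RenSub σ ρ τ → ∀ p → renP ρ (subP σ p) ≡ subP τ p
  renP-subP H (t ∗ π) = cong₂ _∗_ (renT-subT H t) (renS-subS H π)

record SubSub (σ τ υ : Sub) : Set where
  field
    ss-λ : ∀ x → subV τ (sλ σ x) ≡ sλ υ x
    ss-s : ∀ α → subS τ (ss σ α) ≡ ss υ α
    ss-t : ∀ a → subT τ (st σ a) ≡ st υ a
open SubSub

-- Both sides of each equation below are the substitution by τ followed by the shift.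
subSub-liftλ : ∀ {σ τ υ} → SubSub σ τ υ → SubSub (liftλ σ) (liftλ τ) (liftλ υ)
ss-λ (subSub-liftλ H) zero = refl
ss-λ (subSub-liftλ {σ} {τ} H) (suc x) =
  trans (subV-renV (subRen-S∘R shλ (liftλ τ)) (sλ σ x))
        (trans (sym (renV-subV (renSub-R∘S τ shλ) (sλ σ x))) (cong (renV shλ) (ss-λ H x)))
ss-s (subSub-liftλ {σ} {τ} H) α =
  trans (subS-renS (subRen-S∘R shλ (liftλ τ)) (ss σ α))
        (trans (sym (renS-subS (renSub-R∘S τ shλ) (ss σ α))) (cong (renS shλ) (ss-s H α)))
ss-t (subSub-liftλ {σ} {τ} H) a =
  trans (subT-renT (subRen-S∘R shλ (liftλ τ)) (st σ a))
        (trans (sym (renT-subT (renSub-R∘S τ shλ) (st σ a))) (cong (renT shλ) (ss-t H a)))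

subSub-liftμ : ∀ {σ τ υ} → SubSub σ τ υ → SubSub (liftμ σ) (liftμ τ) (liftμ υ)
ss-λ (subSub-liftμ {σ} {τ} H) x =
  trans (subV-renV (subRen-S∘R shμ (liftμ τ)) (sλ σ x))
        (trans (sym (renV-subV (renSub-R∘S τ shμ) (sλ σ x))) (cong (renV shμ) (ss-λ H x)))
ss-s (subSub-liftμ H) zero = refl
ss-s (subSub-liftμ {σ} {τ} H) (suc α) =
  trans (subS-renS (subRen-S∘R shμ (liftμ τ)) (ss σ α))
        (trans (sym (renS-subS (renSub-R∘S τ shμ) (ss σ α))) (cong (renS shμ) (ss-s H α)))
ss-t (subSub-liftμ {σ} {τ} H) a =
  trans (subT-renT (subRen-S∘R shμ (liftμ τ)) (st σ a))
        (trans (sym (renT-subT (renSub-R∘S τ shμ) (st σ a))) (cong (renT shμ) (ss-t H a)))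

mutual
  subV-subV : ∀ {σ τ υ} → SubSub σ τ υ → ∀ v → subV τ (subV σ v) ≡ subV υ v
  subV-subV H (var x)   = ss-λ H x
  subV-subV H (lam t)   = cong lam (subT-subT (subSub-liftλ H) t)
  subV-subV H (con c v) = cong (con c) (subV-subV H v)
  subV-subV H (rec fs)  = cong rec (subFs-subFs H fs)

  subFs-subFs : ∀ {σ τ υ} → SubSub σ τ υ → ∀ fs → subFs τ (subFs σ fs) ≡ subFs υ fs
  subFs-subFs H []             = refl
  subFs-subFs H (nothing ∷ fs) = cong (nothing ∷_) (subFs-subFs H fs)
  subFs-subFs H (just v ∷ fs)  = cong₂ (λ w ws → just w ∷ ws) (subV-subV H v) (subFs-subFs H fs)

  subBs-subBs : ∀ {σ τ υ} → SubSub σ τ υ → ∀ bs → subBs τ (subBs σ bs) ≡ subBs υ bs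
  subBs-subBs H []             = refl
  subBs-subBs H (nothing ∷ bs) = cong (nothing ∷_) (subBs-subBs H bs)
  subBs-subBs H (just t ∷ bs)  =
    cong₂ (λ s ss → just s ∷ ss) (subT-subT (subSub-liftλ H) t) (subBs-subBs H bs)

  subT-subT : ∀ {σ τ υ} → SubSub σ τ υ → ∀ t → subT τ (subT σ t) ≡ subT υ t
  subT-subT H (tvar a)    = ss-t H a
  subT-subT H (val v)     = cong val (subV-subV H v)
  subT-subT H (app t u)   = cong₂ app (subT-subT H t) (subT-subT H u)
  subT-subT H (mu t)      = cong mu (subT-subT (subSub-liftμ H) t)
  subT-subT H (proc p)    = cong proc (subP-subP H p)
  subT-subT H (proj v l)  = cong (λ w → proj w l) (subV-subV H v)
  subT-subT H (case v bs) = cong₂ case (subV-subV H v) (subBs-subBs H bs)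
  subT-subT H (delta v w) = cong₂ delta (subV-subV H v) (subV-subV H w)

  subS-subS : ∀ {σ τ υ} → SubSub σ τ υ → ∀ π → subS τ (subS σ π) ≡ subS υ π
  subS-subS H (svar α)    = ss-s H α
  subS-subS H (push v π)  = cong₂ push (subV-subV H v) (subS-subS H π)
  subS-subS H (frame t π) = cong₂ frame (subT-subT H t) (subS-subS H π)

  subP-subP : ∀ {σ τ υ} → SubSub σ τ υ → ∀ p → subP τ (subP σ p) ≡ subP υ p
  subP-subP H (t ∗ π) = cong₂ _∗_ (subT-subT H t) (subS-subS H π)

record IsIdSub (σ : Sub) : Set where
  field
    id-λ : ∀ x → sλ σ x ≡ var x
    id-s : ∀ α → ss σ α ≡ svar α
    id-t : ∀ a → st σ a ≡ tvar a
open IsIdSub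

isIdSub-idS : IsIdSub idS
id-λ isIdSub-idS x = refl
id-s isIdSub-idS α = refl
id-t isIdSub-idS a = refl

isIdSub-liftλ : ∀ {σ} → IsIdSub σ → IsIdSub (liftλ σ)
id-λ (isIdSub-liftλ H) zero    = refl
id-λ (isIdSub-liftλ H) (suc x) = cong (renV shλ) (id-λ H x)
id-s (isIdSub-liftλ H) α       = cong (renS shλ) (id-s H α)
id-t (isIdSub-liftλ H) a       = cong (renT shλ) (id-t H a)

isIdSub-liftμ : ∀ {σ} → IsIdSub σ → IsIdSub (liftμ σ)
id-λ (isIdSub-liftμ H) x       = cong (renV shμ) (id-λ H x)
id-s (isIdSub-liftμ H) zero    = refl
id-s (isIdSub-liftμ H) (suc α) = cong (renS shμ) (id-s H α)
id-t (isIdSub-liftμ H) a       = cong (renT shμ) (id-t H a)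

mutual
  subV-id : ∀ {σ} → IsIdSub σ → ∀ v → subV σ v ≡ v
  subV-id H (var x)   = id-λ H x
  subV-id H (lam t)   = cong lam (subT-id (isIdSub-liftλ H) t)
  subV-id H (con c v) = cong (con c) (subV-id H v)
  subV-id H (rec fs)  = cong rec (subFs-id H fs)

  subFs-id : ∀ {σ} → IsIdSub σ → ∀ fs → subFs σ fs ≡ fs
  subFs-id H []             = refl
  subFs-id H (nothing ∷ fs) = cong (nothing ∷_) (subFs-id H fs)
  subFs-id H (just v ∷ fs)  = cong₂ (λ w ws → just w ∷ ws) (subV-id H v) (subFs-id H fs)

  subBs-id : ∀ {σ} → IsIdSub σ → ∀ bs → subBs σ bs ≡ bs
  subBs-id H []             = refl
  subBs-id H (nothing ∷ bs) = cong (nothing ∷_) (subBs-id H bs)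
  subBs-id H (just t ∷ bs)  = cong₂ (λ s ss → just s ∷ ss) (subT-id (isIdSub-liftλ H) t) (subBs-id H bs)

  subT-id : ∀ {σ} → IsIdSub σ → ∀ t → subT σ t ≡ t
  subT-id H (tvar a)    = id-t H a
  subT-id H (val v)     = cong val (subV-id H v)
  subT-id H (app t u)   = cong₂ app (subT-id H t) (subT-id H u)
  subT-id H (mu t)      = cong mu (subT-id (isIdSub-liftμ H) t)
  subT-id H (proc p)    = cong proc (subP-id H p)
  subT-id H (proj v l)  = cong (λ w → proj w l) (subV-id H v)
  subT-id H (case v bs) = cong₂ case (subV-id H v) (subBs-id H bs)
  subT-id H (delta v w) = cong₂ delta (subV-id H v) (subV-id H w)

  subS-id : ∀ {σ} → IsIdSub σ → ∀ π → subS σ π ≡ π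
  subS-id H (svar α)    = id-s H α
  subS-id H (push v π)  = cong₂ push (subV-id H v) (subS-id H π)
  subS-id H (frame t π) = cong₂ frame (subT-id H t) (subS-id H π)

  subP-id : ∀ {σ} → IsIdSub σ → ∀ p → subP σ p ≡ p
  subP-id H (t ∗ π) = cong₂ _∗_ (subT-id H t) (subS-id H π)

-- Both sides are t under σ extended by σ v (resp. σ π) at index 0.
subT-[λ:=] : ∀ σ t v → subT σ (t [λ:= v ]) ≡ subT (liftλ σ) t [λ:= subV σ v ]
subT-[λ:=] σ t v = trans (subT-subT outer t) (sym (subT-subT inner t))
  where
  β : Sub
  β = record idS { sλ = cons (subV σ v) var }
  υ : Sub
  υ = record σ { sλ = cons (subV σ v) (sλ σ) }
  outer : SubSub (record idS { sλ = cons v var }) σ υ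
  ss-λ outer zero    = refl
  ss-λ outer (suc x) = refl
  ss-s outer α       = refl
  ss-t outer a       = refl
  inner : SubSub (liftλ σ) β υ
  ss-λ inner zero    = refl
  ss-λ inner (suc x) = trans (subV-renV (subRen-S∘R shλ β) (sλ σ x)) (subV-id isIdSub-idS (sλ σ x))
  ss-s inner α       = trans (subS-renS (subRen-S∘R shλ β) (ss σ α)) (subS-id isIdSub-idS (ss σ α))
  ss-t inner a       = trans (subT-renT (subRen-S∘R shλ β) (st σ a)) (subT-id isIdSub-idS (st σ a))

subT-[μ:=] : ∀ σ t π → subT σ (t [μ:= π ]) ≡ subT (liftμ σ) t [μ:= subS σ π ]
subT-[μ:=] σ t π = trans (subT-subT outer t) (sym (subT-subT inner t))
  where
  β : Sub
  β = record idS { ss = cons (subS σ π) svar }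
  υ : Sub
  υ = record σ { ss = cons (subS σ π) (ss σ) }
  outer : SubSub (record idS { ss = cons π svar }) σ υ
  ss-λ outer x       = refl
  ss-s outer zero    = refl
  ss-s outer (suc α) = refl
  ss-t outer a       = refl
  inner : SubSub (liftμ σ) β υ
  ss-λ inner x       = trans (subV-renV (subRen-S∘R shμ β) (sλ σ x)) (subV-id isIdSub-idS (sλ σ x))
  ss-s inner zero    = refl
  ss-s inner (suc α) = trans (subS-renS (subRen-S∘R shμ β) (ss σ α)) (subS-id isIdSub-idS (ss σ α))
  ss-t inner a       = trans (subT-renT (subRen-S∘R shμ β) (st σ a)) (subT-id isIdSub-idS (st σ a))

lookupM-subFs : ∀ σ fs l {v} → lookupM fs l ≡ just v → lookupM (subFs σ fs) l ≡ just (subV σ v)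
lookupM-subFs σ (nothing ∷ fs) (suc l) e = lookupM-subFs σ fs l e
lookupM-subFs σ (just w ∷ fs)  (suc l) e = lookupM-subFs σ fs l e
lookupM-subFs σ (just w ∷ fs)  zero refl = refl

lookupM-subBs : ∀ σ bs k {t} → lookupM bs k ≡ just t →
  lookupM (subBs σ bs) k ≡ just (subT (liftλ σ) t)
lookupM-subBs σ (nothing ∷ bs) (suc k) e = lookupM-subBs σ bs k e
lookupM-subBs σ (just w ∷ bs)  (suc k) e = lookupM-subBs σ bs k e
lookupM-subBs σ (just w ∷ bs)  zero refl = refl

subP-≻ : ∀ σ {p q} → p ≻ q → subP σ p ≻ subP σ q
subP-≻ σ ≻-app  = ≻-app
subP-≻ σ ≻-frame = ≻-frame
subP-≻ σ (≻-lam {t} {v} {π}) =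
  subst (λ s → subP σ (val (lam t) ∗ push v π) ≻ s ∗ subS σ π) (sym (subT-[λ:=] σ t v)) ≻-lam
subP-≻ σ (≻-mu {t} {π}) =
  subst (λ s → subP σ (mu t ∗ π) ≻ s ∗ subS σ π) (sym (subT-[μ:=] σ t π)) ≻-mu
subP-≻ σ ≻-proc = ≻-proc
subP-≻ σ (≻-proj {fs} {l} e) = ≻-proj (lookupM-subFs σ fs l e)
subP-≻ σ (≻-case {k} {v} {bs} {t} {π} e) =
  subst (λ s → subP σ (case (con k v) bs ∗ π) ≻ s ∗ subS σ π) (sym (subT-[λ:=] σ t v))
    (≻-case (lookupM-subBs σ bs k e))

subP-≻* : ∀ σ {p q} → Star _≻_ p q → Star _≻_ (subP σ p) (subP σ q)
subP-≻* σ ε        = ε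
subP-≻* σ (s ◅ ss) = subP-≻ σ s ◅ subP-≻* σ ss

≻-deterministic : ∀ {p q r} → p ≻ q → p ≻ r → q ≡ r
≻-deterministic ≻-app    ≻-app    = refl
≻-deterministic ≻-frame  ≻-frame  = refl
≻-deterministic ≻-lam    ≻-lam    = refl
≻-deterministic ≻-mu     ≻-mu     = refl
≻-deterministic ≻-proc   ≻-proc   = refl
≻-deterministic (≻-proj e) (≻-proj e′) with just-injective (trans (sym e) e′)
... | refl = refl
≻-deterministic (≻-case e) (≻-case e′) with just-injective (trans (sym e) e′)
... | refl = refl

final-≻-irreducible : ∀ {p q} → Final p → p ≻ q → ⊥
final-≻-irreducible {val v ∗ svar α} _ ()

record Extends≻Deterministically (R : Proc → Proc → Set) : Set where
  field
    ≻⊆R     : ∀ {p q} → p ≻ q → R p q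
    R-agrees : ∀ {p q r} → p ≻ q → R p r → q ≡ r
open Extends≻Deterministically

Red-extends≻ : ∀ i → Extends≻Deterministically (Red i)
≻⊆R     (Red-extends≻ i) = inj₁
R-agrees (Red-extends≻ i) s (inj₁ s′) = ≻-deterministic s s′
R-agrees (Red-extends≻ i) () (inj₂ (v , w , π , refl , _ , _))

module _ {R : Proc → Proc → Set} (R-ext : Extends≻Deterministically R) where

  Conv-≻-forward : ∀ {p q} → p ≻ q → Conv R p → Conv R q
  Conv-≻-forward s (r , ε , f)        = ⊥-elim (final-≻-irreducible f s)
  Conv-≻-forward s (r , (s′ ◅ ss) , f) with R-agrees R-ext s s′
  ... | refl = r , ss , f

  Conv-≻*-forward : ∀ {p q} → Star _≻_ p q → Conv R p → Conv R q
  Conv-≻*-forward ε        c = c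
  Conv-≻*-forward (s ◅ ss) c = Conv-≻*-forward ss (Conv-≻-forward s c)

  Conv-≻*-backward : ∀ {p q} → Star _≻_ p q → Conv R q → Conv R p
  Conv-≻*-backward ε        c = c
  Conv-≻*-backward (s ◅ ss) c with Conv-≻*-backward ss c
  ... | r , steps , f = r , (≻⊆R R-ext s ◅ steps) , f

-- Strict upper bounds on the free stack variables.
mutual
  fsvV : Val → ℕ
  fsvV (var x)   = 0
  fsvV (lam t)   = fsvT t
  fsvV (con c v) = fsvV v
  fsvV (rec fs)  = fsvFs fs

  fsvFs : List (Maybe Val) → ℕ
  fsvFs []             = 0
  fsvFs (nothing ∷ fs) = fsvFs fs
  fsvFs (just v ∷ fs)  = fsvV v ⊔ fsvFs fs

  fsvBs : List (Maybe Term) → ℕ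
  fsvBs []             = 0
  fsvBs (nothing ∷ bs) = fsvBs bs
  fsvBs (just t ∷ bs)  = fsvT t ⊔ fsvBs bs

  fsvT : Term → ℕ
  fsvT (tvar a)    = 0
  fsvT (val v)     = fsvV v
  fsvT (app t u)   = fsvT t ⊔ fsvT u
  fsvT (mu t)      = pred (fsvT t)
  fsvT (proc p)    = fsvP p
  fsvT (proj v l)  = fsvV v
  fsvT (case v bs) = fsvV v ⊔ fsvBs bs
  fsvT (delta v w) = fsvV v ⊔ fsvV w

  fsvS : Stack → ℕ
  fsvS (svar α)    = suc α
  fsvS (push v π)  = fsvV v ⊔ fsvS π
  fsvS (frame t π) = fsvT t ⊔ fsvS π

  fsvP : Proc → ℕ
  fsvP (t ∗ π) = fsvT t ⊔ fsvS π

record AgreeBelow (n : ℕ) (σ σ′ : Sub) : Set where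
  field
    agree-λ : ∀ x → sλ σ x ≡ sλ σ′ x
    agree-s : ∀ α → α < n → ss σ α ≡ ss σ′ α
    agree-t : ∀ a → st σ a ≡ st σ′ a
open AgreeBelow

agreeBelow-liftλ : ∀ {n σ σ′} → AgreeBelow n σ σ′ → AgreeBelow n (liftλ σ) (liftλ σ′)
agree-λ (agreeBelow-liftλ H) zero    = refl
agree-λ (agreeBelow-liftλ H) (suc x) = cong (renV shλ) (agree-λ H x)
agree-s (agreeBelow-liftλ H) α α<n   = cong (renS shλ) (agree-s H α α<n)
agree-t (agreeBelow-liftλ H) a       = cong (renT shλ) (agree-t H a)

agreeBelow-liftμ : ∀ {n σ σ′} → AgreeBelow n σ σ′ → AgreeBelow (suc n) (liftμ σ) (liftμ σ′)
agree-λ (agreeBelow-liftμ H) x                   = cong (renV shμ) (agree-λ H x)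
agree-s (agreeBelow-liftμ H) zero    _           = refl
agree-s (agreeBelow-liftμ H) (suc α) (s≤s α<n)   = cong (renS shμ) (agree-s H α α<n)
agree-t (agreeBelow-liftμ H) a                   = cong (renT shμ) (agree-t H a)

pred≤⇒≤suc : ∀ m {n} → pred m ≤ n → m ≤ suc n
pred≤⇒≤suc zero    _ = z≤n
pred≤⇒≤suc (suc m) h = s≤s h

mutual
  subV-cong : ∀ {n σ σ′} → AgreeBelow n σ σ′ → ∀ v → fsvV v ≤ n → subV σ v ≡ subV σ′ v
  subV-cong H (var x)   _ = agree-λ H x
  subV-cong H (lam t)   h = cong lam (subT-cong (agreeBelow-liftλ H) t h)
  subV-cong H (con c v) h = cong (con c) (subV-cong H v h)
  subV-cong H (rec fs)  h = cong rec (subFs-cong H fs h)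

  subFs-cong : ∀ {n σ σ′} → AgreeBelow n σ σ′ → ∀ fs → fsvFs fs ≤ n → subFs σ fs ≡ subFs σ′ fs
  subFs-cong H []             _ = refl
  subFs-cong H (nothing ∷ fs) h = cong (nothing ∷_) (subFs-cong H fs h)
  subFs-cong H (just v ∷ fs)  h =
    cong₂ (λ w ws → just w ∷ ws) (subV-cong H v (m⊔n≤o⇒m≤o _ _ h)) (subFs-cong H fs (m⊔n≤o⇒n≤o _ _ h))

  subBs-cong : ∀ {n σ σ′} → AgreeBelow n σ σ′ → ∀ bs → fsvBs bs ≤ n → subBs σ bs ≡ subBs σ′ bs
  subBs-cong H []             _ = refl
  subBs-cong H (nothing ∷ bs) h = cong (nothing ∷_) (subBs-cong H bs h)
  subBs-cong H (just t ∷ bs)  h =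
    cong₂ (λ s ss → just s ∷ ss) (subT-cong (agreeBelow-liftλ H) t (m⊔n≤o⇒m≤o _ _ h))
                                 (subBs-cong H bs (m⊔n≤o⇒n≤o _ _ h))

  subT-cong : ∀ {n σ σ′} → AgreeBelow n σ σ′ → ∀ t → fsvT t ≤ n → subT σ t ≡ subT σ′ t
  subT-cong H (tvar a)    _ = agree-t H a
  subT-cong H (val v)     h = cong val (subV-cong H v h)
  subT-cong H (app t u)   h = cong₂ app (subT-cong H t (m⊔n≤o⇒m≤o _ _ h)) (subT-cong H u (m⊔n≤o⇒n≤o _ _ h))
  subT-cong H (mu t)      h = cong mu (subT-cong (agreeBelow-liftμ H) t (pred≤⇒≤suc (fsvT t) h))
  subT-cong H (proc p)    h = cong proc (subP-cong H p h)
  subT-cong H (proj v l)  h = cong (λ w → proj w l) (subV-cong H v h)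
  subT-cong H (case v bs) h = cong₂ case (subV-cong H v (m⊔n≤o⇒m≤o _ _ h)) (subBs-cong H bs (m⊔n≤o⇒n≤o _ _ h))
  subT-cong H (delta v w) h = cong₂ delta (subV-cong H v (m⊔n≤o⇒m≤o _ _ h)) (subV-cong H w (m⊔n≤o⇒n≤o _ _ h))

  subS-cong : ∀ {n σ σ′} → AgreeBelow n σ σ′ → ∀ π → fsvS π ≤ n → subS σ π ≡ subS σ′ π
  subS-cong H (svar α)    h = agree-s H α h
  subS-cong H (push v π)  h = cong₂ push (subV-cong H v (m⊔n≤o⇒m≤o _ _ h)) (subS-cong H π (m⊔n≤o⇒n≤o _ _ h))
  subS-cong H (frame t π) h = cong₂ frame (subT-cong H t (m⊔n≤o⇒m≤o _ _ h)) (subS-cong H π (m⊔n≤o⇒n≤o _ _ h))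

  subP-cong : ∀ {n σ σ′} → AgreeBelow n σ σ′ → ∀ p → fsvP p ≤ n → subP σ p ≡ subP σ′ p
  subP-cong H (t ∗ π) h = cong₂ _∗_ (subT-cong H t (m⊔n≤o⇒m≤o _ _ h)) (subS-cong H π (m⊔n≤o⇒n≤o _ _ h))

_[_↦_] : (ℕ → Stack) → ℕ → Stack → ℕ → Stack
(f [ α ↦ π ]) β with β ≟ α
... | yes _ = π
... | no  _ = f β

[↦]-hit : ∀ f α π → (f [ α ↦ π ]) α ≡ π
[↦]-hit f α π with α ≟ α
... | yes _   = refl
... | no  α≢α = ⊥-elim (α≢α refl)

[↦]-miss : ∀ f {α β} π → β < α → (f [ α ↦ π ]) β ≡ f β
[↦]-miss f {α} {β} π β<α with β ≟ α
... | yes β≡α = ⊥-elim (<⇒≢ β<α β≡α)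
... | no  _   = refl

Joinable : Term → Term → Set
Joinable t u = (π : Stack) → Σ Proc (λ p → Star _≻_ (t ∗ π) p × Star _≻_ (u ∗ π) p)

Joinable-subT : ∀ {t u} → Joinable t u → ∀ σ → Joinable (subT σ t) (subT σ u)
Joinable-subT {t} {u} J σ π with J (svar (fsvT t ⊔ fsvT u))
... | p , t↠p , u↠p = subP σ′ p , instantiate t (m≤m⊔n _ _) t↠p , instantiate u (m≤n⊔m _ _) u↠p
  where
  α : ℕ
  α = fsvT t ⊔ fsvT u
  σ′ : Sub
  σ′ = record σ { ss = ss σ [ α ↦ π ] }
  σ′≈σ : AgreeBelow α σ′ σ
  agree-λ σ′≈σ x         = refl
  agree-s σ′≈σ β β<α     = [↦]-miss (ss σ) π β<α
  agree-t σ′≈σ a         = refl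
  instantiate : ∀ s → fsvT s ≤ α → Star _≻_ (s ∗ svar α) p → Star _≻_ (subT σ s ∗ π) (subP σ′ p)
  instantiate s s-fresh s↠p =
    subst (λ q → Star _≻_ q (subP σ′ p))
          (cong₂ _∗_ (subT-cong σ′≈σ s s-fresh) ([↦]-hit (ss σ) α π))
          (subP-≻* σ′ s↠p)

Joinable⇒ObsEq : ∀ {R t u} → Extends≻Deterministically R → Joinable t u → ObsEq R t u
Joinable⇒ObsEq R-ext J π σ with Joinable-subT J σ π
... | p , t↠p , u↠p =
  (λ c → Conv-≻*-backward R-ext u↠p (Conv-≻*-forward R-ext t↠p c)) ,
  (λ c → Conv-≻*-backward R-ext t↠p (Conv-≻*-forward R-ext u↠p c))

Joinable⇒Equiv : ∀ {t u} → Joinable t u → ∀ i → Equiv i t u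
Joinable⇒Equiv J zero    = Joinable⇒ObsEq (Red-extends≻ zero) J
Joinable⇒Equiv J (suc i) = Joinable⇒Equiv J i , Joinable⇒ObsEq (Red-extends≻ (suc i)) J

lemma9 : (t u : Term) →
    ((π : Stack) → Σ Proc (λ p → Star _≻_ (t ∗ π) p × Star _≻_ (u ∗ π) p)) →
    t ≡obs u
lemma9 t u = Joinable⇒Equiv
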